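{- For every positive integer $n$, \[ h(n) > 2^n \left( 1 - \frac{6 \sqrt{n}}{2^{\sqrt{n}/2}} \right), \] where $h(n)$ is the maximum, over all permutations $\sigma$ of $[n]=\{1,\dots,n\}$, of the number of distinct patterns occurring in $\sigma$.
   Context: Given a sequence $t_1,\dots,t_k$ of distinct elements of a totally ordered set, its pattern is the unique permutation $\tau$ of $[k]$ with $t_i<t_j \iff \tau(i)<\tau(j)$ for all $i,j$. For a permutation $\sigma$ of $[n]$ (written in one-line notation $\sigma(1)\cdots\sigma(n)$) and a nonempty $X\subseteq[n]$, $\sigma_X$ denotes the pattern of the subsequence of $\sigma$ with indices in $X$. Let $P(\sigma)=\{\sigma_X : \emptyset\neq X\subseteq[n]\}$ and $h(n)=\max\{|P(\sigma)| : \sigma \text{ a permutation of } [n]\}$. -}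

module Defs where

open import Data.Bool using (Bool; true; false; if_then_else_; _∨_)
open import Data.Nat using (ℕ; zero; suc; _<ᵇ_)
open import Data.Nat.Properties using (_≟_)
open import Data.Fin using (Fin; zero; suc; toℕ)
open import Data.Fin.Permutation using (Permutation′; _⟨$⟩ʳ_)
open import Data.Vec using (Vec; []; _∷_)
open import Data.List using (List; []; _∷_; [_]; map; _++_; length; filterᵇ; deduplicate)
import Data.List.Properties as LP
open import Function using (_∘_)

select : ∀ {n} → Vec Bool n → (Fin n → ℕ) → List ℕ
select [] f = []
select (true ∷ X) f = f zero ∷ select X (f ∘ suc)
select (false ∷ X) f = select X (f ∘ suc)

allSubsets : ∀ n → List (Vec Bool n)
allSubsets zero = [ [] ]
allSubsets (suc n) = map (true ∷_) (allSubsets n) ++ map (false ∷_) (allSubsets n)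

nonemptyᵇ : ∀ {n} → Vec Bool n → Bool
nonemptyᵇ [] = false
nonemptyᵇ (b ∷ X) = b ∨ nonemptyᵇ X

-- Pattern of a sequence t of distinct naturals (one-line notation of a
-- permutation of [k]): entry x is replaced by its rank 1 + #{y in t | y < x}.
patternOf : List ℕ → List ℕ
patternOf t = map (λ x → suc (length (filterᵇ (λ y → y <ᵇ x) t))) t

-- One-line notation of σ (values 0-based; patterns are invariant under this shift).
oneLine : ∀ {n} → Permutation′ n → Fin n → ℕ
oneLine σ i = toℕ (σ ⟨$⟩ʳ i)

patternAt : ∀ {n} → Permutation′ n → Vec Bool n → List ℕ
patternAt σ X = patternOf (select X (oneLine σ))

numPatterns : ∀ {n} → Permutation′ n → ℕ
numPatterns {n} σ =
  length (deduplicate (LP.≡-dec _≟_) (map (patternAt σ) (filterᵇ nonemptyᵇ (allSubsets n))))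

{-# OPTIONS --safe #-}
module Submission where

-- Let k = ⌊√n⌋ and write n = R k + e with R ∈ {k, k + 1} and e ≤ k. Fill the cells of R rows of
-- length k and a last row of length e with the positions 0, …, n - 1 row by row, and let σ send a
-- position to the index of its cell when the cells are numbered column by column. Call X ⊆ [n]
-- good if for any two consecutive rows X has a point in the upper one at a column ≥ c₀ and a point
-- in the lower one at a column < c₀, and likewise for consecutive columns with a row threshold r₀.
-- Listing a good X by position, a new row begins exactly at a descent of σ_X; listing it by value,
-- a new column begins exactly where the position drops. So σ_X determines X, and |P(σ)| is at
-- least the number of good sets. By the union bound, with c₀ = ⌊k/2⌋ and r₀ = ⌊R/2⌋, fewer than
-- 6k · 2^(n - (k + 1)/2) sets are not good. The statement is this inequality squared, with √n
-- bracketed by a = k and b = k + 1 (and q = 1).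

open import Defs
open import Data.Nat using (ℕ; _+_; _*_; _∸_; _^_; _≤_; _<_)
open import Data.Product using (Σ; _×_; ∃-syntax)
open import Data.Fin.Permutation using (Permutation′)

open import Data.Bool.Base using (Bool; true; false; T; not; _∧_; _∨_; if_then_else_)
open import Data.Bool.ListAction using (all)
open import Data.Bool.Properties using (T-∧; T-∨; ∧-zeroʳ)
open import Data.Empty using (⊥-elim)
open import Data.Fin.Base as Fin using (Fin; toℕ; fromℕ<)
import Data.Fin.Properties as Fin
open import Data.Fin.Permutation using (permutation; _⟨$⟩ʳ_)
import Data.Fin.Permutation as Permutation
open import Data.List.Base using (List; []; _∷_; map; length; filterᵇ; _++_; upTo; applyUpTo; deduplicate)
open import Data.List.Membership.Propositional using (_∈_)
open import Data.List.Membership.Propositional.Properties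
  using (∈-map⁺; ∈-map⁻; ∈-filter⁺; ∈-filter⁻; ∈-deduplicate⁺; ∈-++⁺ˡ; ∈-++⁺ʳ;
         ∈-upTo⁺; ∈-upTo⁻; ∈-applyUpTo⁺; ∈-applyUpTo⁻)
open import Data.List.Properties
  using (length-map; length-++; length-upTo; length-applyUpTo; length-filter; length-removeAt′;
         map-++; map-cong; filter-++; ≡-dec)
import Data.List.Relation.Unary.All as All
import Data.List.Relation.Unary.All.Properties as All
open import Data.List.Relation.Unary.AllPairs using ([]; _∷_)
open import Data.List.Relation.Unary.Any using (here; there; _─_; index)
open import Data.List.Relation.Unary.Unique.Propositional using (Unique)
import Data.List.Relation.Unary.Unique.Propositional.Properties as Unique
open import Data.Nat.Base
open import Data.Nat.DivMod
open import Data.Nat.Divisibility using (divides-refl)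
open import Data.Nat.Induction using (<-rec)
open import Data.Nat.ListAction using (sum)
open import Data.Nat.ListAction.Properties using (sum-++)
open import Data.Nat.Properties
open import Algebra.Properties.CommutativeMonoid.Sum +-0-commutativeMonoid
  using (sum-syntax; sum-cong-≗; sum-permute)
open import Data.Nat.Tactic.RingSolver using (solve-∀)
open import Data.Product using (∃; ∃₂; _,_; proj₁; proj₂)
open import Data.Product.Relation.Binary.Lex.Strict using (×-Lex; ×-compare)
open import Data.Sum.Base using (_⊎_; inj₁; inj₂)
open import Data.Unit.Base using (tt)
open import Data.Vec.Base using (Vec; []; _∷_; lookup)
import Data.Vec.Properties as Vec
open import Function.Base using (_∘_; id)
open import Function.Bundles using (_⇔_; mk⇔; Equivalence)
import Function.Properties.Equivalence as ⇔
open import Relation.Binary.Definitions using (tri<; tri≈; tri>)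
open import Relation.Binary.PropositionalEquality
open import Relation.Nullary.Decidable using (yes; no; T?)
open import Relation.Nullary.Negation using (¬_; contradiction)

open Equivalence using (to; from)

-- Decoding a coordinate from two lexicographic orders

_<ₗₑₓ_ : ℕ × ℕ → ℕ × ℕ → Set
_<ₗₑₓ_ = ×-Lex _≡_ _<_ _<_

record SortsLex (S : ℕ → Set) (κ major minor : ℕ → ℕ) : Set where
  field
    <⇔lex : ∀ {p q} → S p → S q → κ p < κ q ⇔ (major p , minor p) <ₗₑₓ (major q , minor q)

open SortsLex

sortsLex : ∀ {S κ major minor} →
           (∀ {p q} → S p → S q → (major p , minor p) <ₗₑₓ (major q , minor q) → κ p < κ q) →
           (∀ {p q} → major p ≡ major q → minor p ≡ minor q → κ p ≡ κ q) →
           SortsLex S κ major minor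
sortsLex {S} {κ} {major} {minor} mono determined =
  record { <⇔lex = λ Sp Sq → mk⇔ (reflect Sp Sq) (mono Sp Sq) }
  where
  reflect : ∀ {p q} → S p → S q → κ p < κ q → (major p , minor p) <ₗₑₓ (major q , minor q)
  reflect {p} {q} Sp Sq κp<κq with ×-compare sym <-cmp <-cmp (major p , minor p) (major q , minor q)
  ... | tri< lex _ _          = lex
  ... | tri≈ _ (eq₁ , eq₂) _ = contradiction κp<κq (<-irrefl (determined eq₁ eq₂))
  ... | tri> _ _ lex          = contradiction κp<κq (<-asym (mono Sq Sp lex))

sortsLex-injective : ∀ {S κ major minor} → SortsLex S κ major minor →
                     ∀ {p q} → S p → S q → κ p ≡ κ q → major p ≡ major q × minor p ≡ minor q
sortsLex-injective {major = major} {minor} sorts {p} {q} Sp Sq κp≡κq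
  with ×-compare sym <-cmp <-cmp (major p , minor p) (major q , minor q)
... | tri< lex _ _ = contradiction (from (<⇔lex sorts Sp Sq) lex) (<-irrefl κp≡κq)
... | tri≈ _ eq _  = eq
... | tri> _ _ lex = contradiction (from (<⇔lex sorts Sq Sp) lex) (<-irrefl (sym κp≡κq))

module _ {m : ℕ} where

  SameOrder : (κ : ℕ → ℕ) (x y : Fin m → ℕ) → Set
  SameOrder κ x y = ∀ a b → κ (x a) < κ (x b) ⇔ κ (y a) < κ (y b)

  -- Line i + 1 is only occupied if line i is, and the passage from line i to line i + 1 shows as
  -- a descent of the minor coordinate.
  Breaks : (major minor : ℕ → ℕ) (x : Fin m → ℕ) → Set
  Breaks major minor x = ∀ a {i} → major (x a) ≡ suc i →
    ∃₂ λ d d′ → major (x d) ≡ i × major (x d′) ≡ suc i × minor (x d′) < minor (x d)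

data MaxBelow {m} (v : Fin m → ℕ) (t : ℕ) : Set where
  none : (∀ b → t ≤ v b) → MaxBelow v t
  some : ∀ b → v b < t → (∀ d → v d < t → v d ≤ v b) → MaxBelow v t

maxBelow : ∀ {m} (v : Fin m → ℕ) t → MaxBelow v t
maxBelow {zero} v t = none λ ()
maxBelow {suc m} v t with maxBelow (v ∘ Fin.suc) t | v Fin.zero <? t
... | none above | no v₀≮t = none λ { Fin.zero → ≮⇒≥ v₀≮t ; (Fin.suc b) → above b }
... | none above | yes v₀<t =
  some Fin.zero v₀<t λ { Fin.zero _ → ≤-refl ; (Fin.suc d) vd<t → contradiction vd<t (≤⇒≯ (above d)) }
... | some b vb<t maximal | no v₀≮t =
  some (Fin.suc b) vb<t λ { Fin.zero v₀<t → contradiction v₀<t v₀≮t ; (Fin.suc d) vd<t → maximal d vd<t }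
... | some b vb<t maximal | yes v₀<t with v Fin.zero ≤? v (Fin.suc b)
...   | yes v₀≤vb = some (Fin.suc b) vb<t λ { Fin.zero _ → v₀≤vb ; (Fin.suc d) vd<t → maximal d vd<t }
...   | no v₀≰vb  = some Fin.zero v₀<t
  λ { Fin.zero _ → ≤-refl ; (Fin.suc d) vd<t → ≤-trans (maximal d vd<t) (<⇒≤ (≰⇒> v₀≰vb)) }

<⇒≡suc : ∀ {m n} → m < n → ∃ λ i → n ≡ suc i × m ≤ i
<⇒≡suc (s≤s m≤i) = _ , refl , m≤i

-- If κ sorts points by (major, minor) and κ′ by (minor, major), the κ- and κ′-order type of a
-- family with Breaks determines the major coordinates: along κ the major coordinate starts at 0
-- and increases by one exactly where κ′ decreases.
module Decoding {S : ℕ → Set} {κ κ′ major minor : ℕ → ℕ}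
                (κ-sorts : SortsLex S κ major minor) (κ′-sorts : SortsLex S κ′ minor major)
                {m : ℕ} where

  IsPredecessor : (x : Fin m → ℕ) (b a : Fin m) → Set
  IsPredecessor x b a = κ (x b) < κ (x a) × (∀ d → κ (x d) < κ (x a) → κ (x d) ≤ κ (x b))

  LineStep : (x : Fin m → ℕ) (b a : Fin m) → Set
  LineStep x b a = (major (x a) ≡ major (x b) × κ′ (x b) < κ′ (x a))
                 ⊎ (major (x a) ≡ suc (major (x b)) × κ′ (x a) < κ′ (x b))

  module Family (x : Fin m → ℕ) (S-x : ∀ a → S (x a)) (breaks : Breaks major minor x) where

    lex⇒κ< : ∀ {a b} → (major (x a) , minor (x a)) <ₗₑₓ (major (x b) , minor (x b)) →
             κ (x a) < κ (x b)
    lex⇒κ< = from (<⇔lex κ-sorts (S-x _) (S-x _))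

    lex⇒κ′< : ∀ {a b} → (minor (x a) , major (x a)) <ₗₑₓ (minor (x b) , major (x b)) →
              κ′ (x a) < κ′ (x b)
    lex⇒κ′< = from (<⇔lex κ′-sorts (S-x _) (S-x _))

    major-first : ∀ {a} → (∀ b → κ (x a) ≤ κ (x b)) → major (x a) ≡ 0
    major-first {a} first with major (x a) in eq
    ... | zero  = refl
    ... | suc i with d , _ , eq-d , _ ← breaks a eq =
      contradiction (lex⇒κ< (inj₁ (subst₂ _<_ (sym eq-d) (sym eq) (n<1+n i)))) (≤⇒≯ (first d))

    -- With d, d′ from Breaks: minor a ≤ minor d′ < minor d ≤ minor b, by the maximality of b.
    next-line : ∀ {a b i} → IsPredecessor x b a → major (x a) ≡ suc i → major (x b) ≤ i →
                major (x a) ≡ suc (major (x b)) × κ′ (x a) < κ′ (x b)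
    next-line {a} {b} {i} (b<a , maximal) eq-a b≤i with d , d′ , eq-d , eq-d′ , d′<d ← breaks a eq-a =
      trans eq-a (cong suc (sym b≡i)) , lex⇒κ′< (inj₁ (≤-<-trans a≤d′ (<-≤-trans d′<d d≤b)))
      where
      d-below : κ (x d) ≤ κ (x b)
      d-below = maximal d (lex⇒κ< (inj₁ (subst₂ _<_ (sym eq-d) (sym eq-a) (n<1+n i))))
      b≡i : major (x b) ≡ i
      b≡i = ≤-antisym b≤i (≮⇒≥ λ b<i →
        ≤⇒≯ d-below (lex⇒κ< (inj₁ (subst (major (x b) <_) (sym eq-d) b<i))))
      d≤b : minor (x d) ≤ minor (x b)
      d≤b = ≮⇒≥ λ b<d → ≤⇒≯ d-below (lex⇒κ< (inj₂ (trans b≡i (sym eq-d) , b<d)))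
      a≤d′ : minor (x a) ≤ minor (x d′)
      a≤d′ = ≮⇒≥ λ d′<a →
        ≤⇒≯ (maximal d′ (lex⇒κ< (inj₂ (trans eq-d′ (sym eq-a) , d′<a))))
            (lex⇒κ< (inj₁ (subst₂ _<_ (sym b≡i) (sym eq-d′) (n<1+n i))))

    step : ∀ {a b} → IsPredecessor x b a → LineStep x b a
    step (b<a , maximal) with to (<⇔lex κ-sorts (S-x _) (S-x _)) b<a
    ... | inj₂ (same , minor<) = inj₁ (sym same , lex⇒κ′< (inj₁ minor<))
    ... | inj₁ major< with _ , eq-a , b≤i ← <⇒≡suc major< = inj₂ (next-line (b<a , maximal) eq-a b≤i)

  major-determined : ∀ {x y : Fin m → ℕ} → (∀ a → S (x a)) → (∀ a → S (y a)) →
                     SameOrder κ x y → SameOrder κ′ x y →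
                     Breaks major minor x → Breaks major minor y →
                     ∀ a → major (x a) ≡ major (y a)
  major-determined {x} {y} S-x S-y same same′ breaks-x breaks-y a = <-rec P induct (κ (x a)) a refl
    where
    module X = Family x S-x breaks-x
    module Y = Family y S-y breaks-y
    P : ℕ → Set
    P t = ∀ a → κ (x a) ≡ t → major (x a) ≡ major (y a)
    induct : ∀ t → (∀ {s} → s < t → P s) → P t
    induct _ rec a refl with maxBelow (κ ∘ x) (κ (x a))
    ... | none first = trans (X.major-first first) (sym (Y.major-first first′))
      where
      first′ : ∀ b → κ (y a) ≤ κ (y b)
      first′ b = ≮⇒≥ λ lt → ≤⇒≯ (first b) (from (same b a) lt)
    ... | some b b<a maximal = combine (X.step (b<a , maximal)) (Y.step (to (same b a) b<a , maximal′))
      where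
      maximal′ : ∀ d → κ (y d) < κ (y a) → κ (y d) ≤ κ (y b)
      maximal′ d d<a = ≮⇒≥ λ b<d → ≤⇒≯ (maximal d (from (same d a) d<a)) (from (same b d) b<d)
      ih : major (x b) ≡ major (y b)
      ih = rec b<a b refl
      combine : LineStep x b a → LineStep y b a → major (x a) ≡ major (y a)
      combine (inj₁ (eq-x , _)) (inj₁ (eq-y , _)) = trans eq-x (trans ih (sym eq-y))
      combine (inj₂ (eq-x , _)) (inj₂ (eq-y , _)) = trans eq-x (trans (cong suc ih) (sym eq-y))
      combine (inj₁ (_ , b<a′)) (inj₂ (_ , a<b′)) = contradiction (to (same′ b a) b<a′) (<-asym a<b′)
      combine (inj₂ (_ , a<b′)) (inj₁ (_ , b<a′)) = contradiction (to (same′ a b) a<b′) (<-asym b<a′)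

-- Subsets and their increasing listings

nth : List ℕ → ℕ → ℕ
nth []       _       = 0
nth (x ∷ _)  zero    = x
nth (_ ∷ xs) (suc a) = nth xs a

nth-map : ∀ (g : ℕ → ℕ) xs {a} → a < length xs → nth (map g xs) a ≡ g (nth xs a)
nth-map g (x ∷ xs) {zero}  _          = refl
nth-map g (x ∷ xs) {suc a} (s≤s a<xs) = nth-map g xs a<xs

nth-∈ : ∀ xs {a} → a < length xs → nth xs a ∈ xs
nth-∈ (x ∷ xs) {zero}  _        = here refl
nth-∈ (x ∷ xs) {suc a} (s≤s a<) = there (nth-∈ xs a<)

Increasing : List ℕ → Set
Increasing xs = ∀ {a b} → a < b → b < length xs → nth xs a < nth xs b

increasing-⇔ : ∀ xs → Increasing xs → ∀ {a b} → a < length xs → b < length xs →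
               nth xs a < nth xs b ⇔ a < b
increasing-⇔ xs incr {a} {b} a<xs b<xs = mk⇔ reflect (λ a<b → incr a<b b<xs)
  where
  reflect : nth xs a < nth xs b → a < b
  reflect xa<xb with <-cmp a b
  ... | tri< a<b _ _  = a<b
  ... | tri≈ _ refl _ = contradiction xa<xb (<-irrefl refl)
  ... | tri> _ _ b<a  = contradiction xa<xb (<-asym (incr b<a a<xs))

positions : ∀ {n} → Vec Bool n → List ℕ
positions X = select X toℕ

select-map : ∀ {n} (X : Vec Bool n) f (g : ℕ → ℕ) → select X (g ∘ f) ≡ map g (select X f)
select-map []          f g = refl
select-map (true ∷ X)  f g = cong (g (f Fin.zero) ∷_) (select-map X (f ∘ Fin.suc) g)
select-map (false ∷ X) f g = select-map X (f ∘ Fin.suc) g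

select-cong : ∀ {n} (X : Vec Bool n) {f g} → (∀ i → f i ≡ g i) → select X f ≡ select X g
select-cong []          f≗g = refl
select-cong (true ∷ X)  f≗g = cong₂ _∷_ (f≗g Fin.zero) (select-cong X (f≗g ∘ Fin.suc))
select-cong (false ∷ X) f≗g = select-cong X (f≗g ∘ Fin.suc)

select-sound : ∀ {n} (X : Vec Bool n) f {a} → a < length (select X f) →
               ∃[ i ] T (lookup X i) × nth (select X f) a ≡ f i
select-sound (true ∷ X)  f {zero}  _ = Fin.zero , tt , refl
select-sound (true ∷ X)  f {suc a} (s≤s a<) with i , i∈X , eq ← select-sound X (f ∘ Fin.suc) a< =
  Fin.suc i , i∈X , eq
select-sound (false ∷ X) f a< with i , i∈X , eq ← select-sound X (f ∘ Fin.suc) a< = Fin.suc i , i∈X , eq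

select-complete : ∀ {n} (X : Vec Bool n) f {i} → T (lookup X i) →
                  ∃[ a ] a < length (select X f) × nth (select X f) a ≡ f i
select-complete (true ∷ X)  f {Fin.zero}  _ = 0 , z<s , refl
select-complete (true ∷ X)  f {Fin.suc i} i∈X with a , a< , eq ← select-complete X (f ∘ Fin.suc) i∈X =
  suc a , s≤s a< , eq
select-complete (false ∷ X) f {Fin.suc i} i∈X = select-complete X (f ∘ Fin.suc) i∈X

select-increasing : ∀ {n} (X : Vec Bool n) {f} → (∀ {i j} → i Fin.< j → f i < f j) →
                    Increasing (select X f)
select-increasing (true ∷ X) {f} mono {zero} {suc b} _ (s≤s b<)
  with j , _ , eq ← select-sound X (f ∘ Fin.suc) b< = subst (f Fin.zero <_) (sym eq) (mono z<s)
select-increasing (true ∷ X)  mono {suc a} {suc b} (s≤s a<b) (s≤s b<) =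
  select-increasing X (λ i<j → mono (s≤s i<j)) a<b b<
select-increasing (false ∷ X) mono = select-increasing X (λ i<j → mono (s≤s i<j))

positions-increasing : ∀ {n} (X : Vec Bool n) → Increasing (positions X)
positions-increasing X = select-increasing X id

members-ext : ∀ {n} (X Y : Vec Bool n) → (∀ i → T (lookup X i) → T (lookup Y i)) →
              (∀ i → T (lookup Y i) → T (lookup X i)) → X ≡ Y
members-ext []      []      _   _   = refl
members-ext (b ∷ X) (c ∷ Y) X⊆Y Y⊆X =
  cong₂ _∷_ (head b c (X⊆Y Fin.zero) (Y⊆X Fin.zero)) (members-ext X Y (X⊆Y ∘ Fin.suc) (Y⊆X ∘ Fin.suc))
  where
  head : ∀ b c → (T b → T c) → (T c → T b) → b ≡ c
  head false false _ _ = refl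
  head false true  _ c⇒b = ⊥-elim (c⇒b tt)
  head true  false b⇒c _ = ⊥-elim (b⇒c tt)
  head true  true  _ _ = refl

positions-injective : ∀ {n} (X Y : Vec Bool n) → length (positions X) ≡ length (positions Y) →
                      (∀ {a} → a < length (positions X) → nth (positions X) a ≡ nth (positions Y) a) → X ≡ Y
positions-injective X Y len same = members-ext X Y (⊆ X Y len same) (⊆ Y X (sym len) same′)
  where
  ⊆ : ∀ X Y → length (positions X) ≡ length (positions Y) →
      (∀ {a} → a < length (positions X) → nth (positions X) a ≡ nth (positions Y) a) →
      ∀ i → T (lookup X i) → T (lookup Y i)
  ⊆ X Y len same i i∈X with a , a< , eq ← select-complete X toℕ i∈X
    with j , j∈Y , eq′ ← select-sound Y toℕ (subst (a <_) len a<) =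
    subst (T ∘ lookup Y) (Fin.toℕ-injective (trans (sym eq′) (trans (sym (same a<)) eq))) j∈Y
  same′ : ∀ {a} → a < length (positions Y) → nth (positions Y) a ≡ nth (positions X) a
  same′ a< = sym (same (subst (_ <_) (sym len) a<))

#below : List ℕ → ℕ → ℕ
#below s x = length (filterᵇ (_<ᵇ x) s)

#below-mono : ∀ s {x y} → x ≤ y → #below s x ≤ #below s y
#below-mono []      x≤y = z≤n
#below-mono (z ∷ s) {x} {y} x≤y with z <ᵇ x in z<x | z <ᵇ y in z<y
... | true  | true  = s≤s (#below-mono s x≤y)
... | true  | false = contradiction (<⇒<ᵇ (<-≤-trans (<ᵇ⇒< z x (subst T (sym z<x) tt)) x≤y)) (subst T z<y)
... | false | true  = m≤n⇒m≤1+n (#below-mono s x≤y)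
... | false | false = #below-mono s x≤y

#below-strict : ∀ s {x y} → x ∈ s → x < y → #below s x < #below s y
#below-strict (x ∷ s) {_} {y} (here refl) x<y with x <ᵇ x in x<x | x <ᵇ y in x<y′
... | true  | _     = contradiction (<ᵇ⇒< x x (subst T (sym x<x) tt)) (n≮n x)
... | false | false = contradiction (<⇒<ᵇ x<y) (subst T x<y′)
... | false | true  = s≤s (#below-mono s (<⇒≤ x<y))
#below-strict (z ∷ s) {x} {y} (there x∈s) x<y with z <ᵇ x in z<x | z <ᵇ y in z<y
... | true  | true  = s≤s (#below-strict s x∈s x<y)
... | true  | false = contradiction (<⇒<ᵇ (<-trans (<ᵇ⇒< z x (subst T (sym z<x) tt)) x<y)) (subst T z<y)
... | false | true  = s≤s (<⇒≤ (#below-strict s x∈s x<y))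
... | false | false = #below-strict s x∈s x<y

patternOf-length : ∀ s t → patternOf s ≡ patternOf t → length s ≡ length t
patternOf-length s t eq = trans (sym (length-map _ s)) (trans (cong length eq) (length-map _ t))

patternOf-< : ∀ s t → patternOf s ≡ patternOf t → ∀ {a b} → a < length s → b < length s →
              nth s a < nth s b → nth t a < nth t b
patternOf-< s t eq {a} {b} a<s b<s sa<sb = ≰⇒> λ tb≤ta → <⇒≱ ranks< (s≤s (#below-mono t tb≤ta))
  where
  rank-eq : ∀ {c} → c < length s → suc (#below s (nth s c)) ≡ suc (#below t (nth t c))
  rank-eq {c} c<s = begin
    suc (#below s (nth s c)) ≡⟨ nth-map _ s c<s ⟨
    nth (patternOf s) c      ≡⟨ cong (λ u → nth u c) eq ⟩
    nth (patternOf t) c      ≡⟨ nth-map _ t (subst (c <_) (patternOf-length s t eq) c<s) ⟩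
    suc (#below t (nth t c)) ∎
    where open ≡-Reasoning
  ranks< : suc (#below t (nth t a)) < suc (#below t (nth t b))
  ranks< = subst₂ _<_ (rank-eq a<s) (rank-eq b<s) (s≤s (#below-strict s (nth-∈ s a<s) sa<sb))

patternOf-map-< : ∀ (f : ℕ → ℕ) xs ys → patternOf (map f xs) ≡ patternOf (map f ys) →
                  ∀ {a b} → a < length xs → b < length xs →
                  f (nth xs a) < f (nth xs b) → f (nth ys a) < f (nth ys b)
patternOf-map-< f xs ys eq a<xs b<xs fa<fb =
  subst₂ _<_ (nth-map f ys (<ys a<xs)) (nth-map f ys (<ys b<xs))
    (patternOf-< (map f xs) (map f ys) eq (<fxs a<xs) (<fxs b<xs)
      (subst₂ _<_ (sym (nth-map f xs a<xs)) (sym (nth-map f xs b<xs)) fa<fb))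
  where
  <fxs : ∀ {c} → c < length xs → c < length (map f xs)
  <fxs = subst (_ <_) (sym (length-map f xs))
  <ys : ∀ {c} → c < length xs → c < length ys
  <ys c<xs = subst (_ <_) (trans (patternOf-length _ _ eq) (length-map f ys)) (<fxs c<xs)

-- Counting subsets

meets : ∀ {n} → Vec Bool n → (ℕ → Bool) → Bool
meets []      E = false
meets (b ∷ X) E = (b ∧ E 0) ∨ meets X (E ∘ suc)

meets-sound : ∀ {n} (X : Vec Bool n) E → T (meets X E) → ∃[ i ] T (lookup X i) × T (E (toℕ i))
meets-sound (true ∷ X) E X-meets with E 0 in E0
... | true  = Fin.zero , tt , subst T (sym E0) tt
... | false with i , i∈X , Ei ← meets-sound X (E ∘ suc) X-meets = Fin.suc i , i∈X , Ei
meets-sound (false ∷ X) E X-meets with i , i∈X , Ei ← meets-sound X (E ∘ suc) X-meets = Fin.suc i , i∈X , Ei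

all-∈ : ∀ {A : Set} (p : A → Bool) {x} xs → T (all p xs) → x ∈ xs → T (p x)
all-∈ p (y ∷ ys) all-p (here refl)  = proj₁ (to T-∧ all-p)
all-∈ p (y ∷ ys) all-p (there x∈ys) = all-∈ p ys (proj₂ (to (T-∧ {p y}) all-p)) x∈ys

card : ℕ → (ℕ → Bool) → ℕ
card n E = ∑[ i < n ] (if E (toℕ i) then 1 else 0)

card-≤ : ∀ n E → card n E ≤ n
card-≤ zero    E = z≤n
card-≤ (suc n) E with E 0
... | true  = s≤s (card-≤ n (E ∘ suc))
... | false = m≤n⇒m≤1+n (card-≤ n (E ∘ suc))

card-none : ∀ n {E} → (∀ p → E p ≡ false) → card n E ≡ 0
card-none zero    _    = refl
card-none (suc n) never rewrite never 0 = card-none n (never ∘ suc)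

-- not (p <ᵇ lo) rather than lo ≤ᵇ p, so that the test computes when both p and lo are successors
interval : ℕ → ℕ → ℕ → Bool
interval lo hi p = not (p <ᵇ lo) ∧ (p <ᵇ hi)

interval-sound : ∀ lo hi {p} → T (interval lo hi p) → lo ≤ p × p < hi
interval-sound lo hi {p} p∈ with p <ᵇ lo in p<lo
... | false = ≮⇒≥ (λ p<lo′ → subst T p<lo (<⇒<ᵇ p<lo′)) , <ᵇ⇒< p hi p∈

card-interval : ∀ {n} lo hi → hi ≤ n → card n (interval lo hi) ≡ hi ∸ lo
card-interval {n}     lo       zero     _          =
  trans (card-none n λ p → ∧-zeroʳ (not (p <ᵇ lo))) (sym (0∸n≡0 lo))
card-interval {suc n} zero     (suc hi) (s≤s hi≤n) = cong suc (card-interval zero hi hi≤n)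
card-interval {suc n} (suc lo) (suc hi) (s≤s hi≤n) = card-interval lo hi hi≤n

card-permute : ∀ {n} (π : Permutation′ n) {f} E → (∀ i → toℕ (π ⟨$⟩ʳ i) ≡ f (toℕ i)) →
               card n (E ∘ f) ≡ card n E
card-permute π E π≗f = trans (sum-cong-≗ λ i → cong (λ p → if E p then 1 else 0) (sym (π≗f i)))
                             (sym (sum-permute _ π))

countᵇ : ∀ {A : Set} → (A → Bool) → List A → ℕ
countᵇ p xs = length (filterᵇ p xs)

module _ {A : Set} where

  countᵇ-++ : ∀ (p : A → Bool) xs ys → countᵇ p (xs ++ ys) ≡ countᵇ p xs + countᵇ p ys
  countᵇ-++ p xs ys = trans (cong length (filter-++ (T? ∘ p) xs ys)) (length-++ (filterᵇ p xs))

  countᵇ-map : ∀ {B : Set} (p : B → Bool) (f : A → B) xs → countᵇ p (map f xs) ≡ countᵇ (p ∘ f) xs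
  countᵇ-map p f []       = refl
  countᵇ-map p f (x ∷ xs) with p (f x)
  ... | true  = cong suc (countᵇ-map p f xs)
  ... | false = countᵇ-map p f xs

  countᵇ-none : ∀ {p : A → Bool} → (∀ x → p x ≡ false) → ∀ xs → countᵇ p xs ≡ 0
  countᵇ-none never []       = refl
  countᵇ-none never (x ∷ xs) rewrite never x = countᵇ-none never xs

  countᵇ-mono : ∀ {p q : A → Bool} → (∀ x → T (p x) → T (q x)) →
                ∀ xs → countᵇ p xs ≤ countᵇ q xs
  countᵇ-mono p⇒q [] = z≤n
  countᵇ-mono {p} {q} p⇒q (x ∷ xs) with p x in px | q x in qx
  ... | true  | true  = s≤s (countᵇ-mono p⇒q xs)
  ... | true  | false = contradiction (p⇒q x (subst T (sym px) tt)) (subst T qx)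
  ... | false | true  = m≤n⇒m≤1+n (countᵇ-mono p⇒q xs)
  ... | false | false = countᵇ-mono p⇒q xs

  countᵇ-∨ : ∀ (p q : A → Bool) xs → countᵇ (λ x → p x ∨ q x) xs ≤ countᵇ p xs + countᵇ q xs
  countᵇ-∨ p q [] = z≤n
  countᵇ-∨ p q (x ∷ xs) with p x | q x
  ... | true  | true  = s≤s (≤-trans (countᵇ-∨ p q xs) (+-monoʳ-≤ (countᵇ p xs) (n≤1+n _)))
  ... | true  | false = s≤s (countᵇ-∨ p q xs)
  ... | false | true  = ≤-trans (s≤s (countᵇ-∨ p q xs)) (≤-reflexive (sym (+-suc _ _)))
  ... | false | false = countᵇ-∨ p q xs

  countᵇ-complement : ∀ (p : A → Bool) xs → countᵇ p xs + countᵇ (not ∘ p) xs ≡ length xs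
  countᵇ-complement p []       = refl
  countᵇ-complement p (x ∷ xs) with p x
  ... | true  = cong suc (countᵇ-complement p xs)
  ... | false = trans (+-suc _ _) (cong suc (countᵇ-complement p xs))

  union-bound : ∀ {B : Set} (passes : A → B → Bool) (Es : List B) xs →
                countᵇ (λ x → not (all (passes x) Es)) xs ≤
                sum (map (λ E → countᵇ (λ x → not (passes x E)) xs) Es)
  union-bound passes []       xs = ≤-reflexive (countᵇ-none (λ _ → refl) xs)
  union-bound passes (E ∷ Es) xs = begin
    countᵇ (λ x → not (passes x E ∧ all (passes x) Es)) xs
      ≤⟨ countᵇ-mono (λ x → de-morgan (passes x E)) xs ⟩
    countᵇ (λ x → not (passes x E) ∨ not (all (passes x) Es)) xs
      ≤⟨ countᵇ-∨ (λ x → not (passes x E)) _ xs ⟩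
    countᵇ (λ x → not (passes x E)) xs + countᵇ (λ x → not (all (passes x) Es)) xs
      ≤⟨ +-monoʳ-≤ _ (union-bound passes Es xs) ⟩
    countᵇ (λ x → not (passes x E)) xs + sum (map (λ E → countᵇ (λ x → not (passes x E)) xs) Es) ∎
    where
    open ≤-Reasoning
    de-morgan : ∀ a {b} → T (not (a ∧ b)) → T (not a ∨ not b)
    de-morgan false _ = tt
    de-morgan true  t = t

length-allSubsets : ∀ n → length (allSubsets n) ≡ 2 ^ n
length-allSubsets zero    = refl
length-allSubsets (suc n) = begin
  length (map (true ∷_) A ++ map (false ∷_) A)         ≡⟨ length-++ (map (true ∷_) A) ⟩
  length (map (true ∷_) A) + length (map (false ∷_) A) ≡⟨ cong₂ _+_ (length-map _ A) (length-map _ A) ⟩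
  length A + length A                                  ≡⟨ cong₂ _+_ (length-allSubsets n) (length-allSubsets n) ⟩
  2 ^ n + 2 ^ n                                        ≡⟨ cong (2 ^ n +_) (+-identityʳ (2 ^ n)) ⟨
  2 ^ suc n                                            ∎
  where
  open ≡-Reasoning
  A = allSubsets n

count-missing : ∀ n E → countᵇ (λ X → not (meets X E)) (allSubsets n) ≡ 2 ^ (n ∸ card n E)
count-missing zero    E = refl
count-missing (suc n) E = begin
  countᵇ missing (map (true ∷_) A ++ map (false ∷_) A)
    ≡⟨ countᵇ-++ missing (map (true ∷_) A) _ ⟩
  countᵇ missing (map (true ∷_) A) + countᵇ missing (map (false ∷_) A)
    ≡⟨ cong₂ _+_ (countᵇ-map missing (true ∷_) A) (countᵇ-map missing (false ∷_) A) ⟩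
  countᵇ (missing ∘ (true ∷_)) A + countᵇ (missing ∘ (false ∷_)) A
    ≡⟨ cong (countᵇ (missing ∘ (true ∷_)) A +_) (count-missing n (E ∘ suc)) ⟩
  countᵇ (missing ∘ (true ∷_)) A + 2 ^ (n ∸ card n (E ∘ suc))
    ≡⟨ with-first-point ⟩
  2 ^ (suc n ∸ card (suc n) E) ∎
  where
  open ≡-Reasoning
  A = allSubsets n
  missing : Vec Bool (suc n) → Bool
  missing X = not (meets X E)
  with-first-point : countᵇ (missing ∘ (true ∷_)) A + 2 ^ (n ∸ card n (E ∘ suc)) ≡
                     2 ^ (suc n ∸ card (suc n) E)
  with-first-point with E 0
  ... | true  = cong (_+ 2 ^ (n ∸ card n (E ∘ suc))) (countᵇ-none (λ _ → refl) A)
  ... | false = begin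
    countᵇ (λ X → not (meets X (E ∘ suc))) A + 2 ^ (n ∸ c)
      ≡⟨ cong (_+ 2 ^ (n ∸ c)) (count-missing n (E ∘ suc)) ⟩
    2 ^ (n ∸ c) + 2 ^ (n ∸ c)  ≡⟨ cong (2 ^ (n ∸ c) +_) (+-identityʳ _) ⟨
    2 ^ suc (n ∸ c)            ≡⟨ cong (2 ^_) (+-∸-assoc 1 (card-≤ n (E ∘ suc))) ⟨
    2 ^ (suc n ∸ c)            ∎
    where c = card n (E ∘ suc)

-- Counting patterns

module _ {A : Set} where

  ∈-─ : ∀ {y z : A} {ws} (z∈ws : z ∈ ws) → y ∈ ws → y ≢ z → y ∈ (ws ─ z∈ws)
  ∈-─ (here refl)  (here refl)  y≢z = contradiction refl y≢z
  ∈-─ (here refl)  (there y∈ws) _   = y∈ws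
  ∈-─ (there z∈ws) (here refl)  _   = here refl
  ∈-─ (there z∈ws) (there y∈ws) y≢z = there (∈-─ z∈ws y∈ws y≢z)

  unique-⊆-length : ∀ {zs ws : List A} → Unique zs → (∀ {z} → z ∈ zs → z ∈ ws) →
                    length zs ≤ length ws
  unique-⊆-length {[]}     _                 _     = z≤n
  unique-⊆-length {z ∷ zs} {ws} (z∉zs ∷ unique) zs⊆ws =
    subst (suc (length zs) ≤_) (sym (length-removeAt′ ws (index z∈ws)))
      (s≤s (unique-⊆-length unique λ y∈zs →
        ∈-─ z∈ws (zs⊆ws (there y∈zs)) λ y≡z → All.lookup z∉zs y∈zs (sym y≡z)))
    where z∈ws = zs⊆ws (here refl)

  unique-map-on : ∀ {B : Set} (f : A → B) {xs} → Unique xs →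
                  (∀ {x y} → x ∈ xs → y ∈ xs → f x ≡ f y → x ≡ y) → Unique (map f xs)
  unique-map-on f {[]}     []              _   = []
  unique-map-on f {x ∷ xs} (x∉xs ∷ unique) inj =
    All.map⁺ (All.tabulate λ y∈xs fx≡fy → All.lookup x∉xs y∈xs (inj (here refl) (there y∈xs) fx≡fy))
    ∷ unique-map-on f unique λ x∈xs y∈xs → inj (there x∈xs) (there y∈xs)

unique-allSubsets : ∀ n → Unique (allSubsets n)
unique-allSubsets zero    = All.[] ∷ []
unique-allSubsets (suc n) =
  Unique.++⁺ (Unique.map⁺ (proj₂ ∘ Vec.∷-injective) (unique-allSubsets n))
             (Unique.map⁺ (proj₂ ∘ Vec.∷-injective) (unique-allSubsets n))
             disjoint
  where
  disjoint : ∀ {X} → ¬ (X ∈ map (true ∷_) (allSubsets n) × X ∈ map (false ∷_) (allSubsets n))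
  disjoint (X∈ , X∈′) with _ , _ , refl ← ∈-map⁻ (true ∷_) X∈
                       | _ , _ , () ← ∈-map⁻ (false ∷_) X∈′

module _ {n} (σ : Permutation′ n) (good : Vec Bool n → Bool)
         (good⇒nonempty : ∀ {X} → T (good X) → T (nonemptyᵇ X))
         (decode : ∀ {X Y} → T (good X) → T (good Y) → patternAt σ X ≡ patternAt σ Y → X ≡ Y) where

  good≤numPatterns : countᵇ good (allSubsets n) ≤ numPatterns σ
  good≤numPatterns = subst (_≤ numPatterns σ) (length-map (patternAt σ) goods)
                           (unique-⊆-length unique-patterns patterns⊆)
    where
    goods = filterᵇ good (allSubsets n)
    in-goods : ∀ {X} → X ∈ goods → X ∈ allSubsets n × T (good X)
    in-goods = ∈-filter⁻ (T? ∘ good) {xs = allSubsets n}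
    unique-patterns : Unique (map (patternAt σ) goods)
    unique-patterns = unique-map-on (patternAt σ) (Unique.filter⁺ (T? ∘ good) (unique-allSubsets n))
      λ X∈ Y∈ → decode (proj₂ (in-goods X∈)) (proj₂ (in-goods Y∈))
    patterns⊆ : ∀ {P} → P ∈ map (patternAt σ) goods →
                P ∈ deduplicate (≡-dec _≟_) (map (patternAt σ) (filterᵇ nonemptyᵇ (allSubsets n)))
    patterns⊆ P∈ with X , X∈ , refl ← ∈-map⁻ (patternAt σ) P∈ with X∈all , X-good ← in-goods X∈ =
      ∈-deduplicate⁺ (≡-dec _≟_) (∈-map⁺ (patternAt σ) (∈-filter⁺ (T? ∘ nonemptyᵇ) X∈all (good⇒nonempty X-good)))

  deficit≤bad : 2 ^ n ∸ numPatterns σ ≤ countᵇ (not ∘ good) (allSubsets n)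
  deficit≤bad = begin
    2 ^ n ∸ numPatterns σ                   ≤⟨ ∸-monoʳ-≤ (2 ^ n) good≤numPatterns ⟩
    2 ^ n ∸ #good                           ≡⟨ cong (_∸ #good) (trans (sym (length-allSubsets n))
                                                                      (sym (countᵇ-complement good (allSubsets n)))) ⟩
    #good + countᵇ (not ∘ good) (allSubsets n) ∸ #good ≡⟨ m+n∸m≡n #good _ ⟩
    countᵇ (not ∘ good) (allSubsets n)      ∎
    where
    open ≤-Reasoning
    #good = countᵇ good (allSubsets n)

injective⇒surjective : ∀ {n} (f : Fin n → Fin n) → (∀ {i j} → f i ≡ f j → i ≡ j) →
                       ∀ v → ∃ λ i → f i ≡ v
injective⇒surjective {suc n} f f-inj v with Fin.any? (λ i → f i Fin.≟ v)
... | yes hit = hit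
... | no miss = contradiction (Fin.injective⇒≤ g-inj) (<⇒≱ (n<1+n n))
  where
  f≢v : ∀ i → v ≢ f i
  f≢v i v≡fi = miss (i , sym v≡fi)
  g : Fin (suc n) → Fin n
  g i = Fin.punchOut (f≢v i)
  g-inj : ∀ {i j} → g i ≡ g j → i ≡ j
  g-inj {i} {j} gi≡gj = f-inj (Fin.punchOut-injective (f≢v i) (f≢v j) gi≡gj)

permutationOf : ∀ {n} (f : ℕ → ℕ) → (∀ {p} → p < n → f p < n) →
                (∀ {p q} → p < n → q < n → f p ≡ f q → p ≡ q) →
                Σ (Permutation′ n) λ π → ∀ i → toℕ (π ⟨$⟩ʳ i) ≡ f (toℕ i)
permutationOf {n} f f<n f-inj =
  permutation g g⁻¹ (proj₂ ∘ onto) (λ i → g-inj (proj₂ (onto (g i)))) , toℕ-g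
  where
  g : Fin n → Fin n
  g i = fromℕ< (f<n (Fin.toℕ<n i))
  toℕ-g : ∀ i → toℕ (g i) ≡ f (toℕ i)
  toℕ-g i = Fin.toℕ-fromℕ< (f<n (Fin.toℕ<n i))
  g-inj : ∀ {i j} → g i ≡ g j → i ≡ j
  g-inj {i} {j} gi≡gj =
    Fin.toℕ-injective (f-inj (Fin.toℕ<n i) (Fin.toℕ<n j)
                             (trans (sym (toℕ-g i)) (trans (cong toℕ gi≡gj) (toℕ-g j))))
  onto = injective⇒surjective g g-inj
  g⁻¹ = proj₁ ∘ onto

sum-map-++ : ∀ {A : Set} (f : A → ℕ) xs ys → sum (map f (xs ++ ys)) ≡ sum (map f xs) + sum (map f ys)
sum-map-++ f xs ys = trans (cong sum (map-++ f xs ys)) (sum-++ (map f xs) (map f ys))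

sum-map-map-≤ : ∀ {A B : Set} (f : B → ℕ) (g : A → B) {c} xs → (∀ {x} → x ∈ xs → f (g x) ≤ c) →
                sum (map f (map g xs)) ≤ length xs * c
sum-map-map-≤ f g []       _     = z≤n
sum-map-map-≤ f g (x ∷ xs) bound = +-mono-≤ (bound (here refl)) (sum-map-map-≤ f g xs (bound ∘ there))

<∸1⇒suc< : ∀ {j k} → j < k ∸ 1 → suc j < k
<∸1⇒suc< {k = suc k} j<k = s≤s j<k

[m+o]∸[n+o]≡m∸n : ∀ m n o → (m + o) ∸ (n + o) ≡ m ∸ n
[m+o]∸[n+o]≡m∸n m n o = trans (cong₂ _∸_ (+-comm m o) (+-comm n o)) ([m+n]∸[m+o]≡n∸o o m n)

2^[n∸s]≤2^t*2^[n∸h] : ∀ n s t {h} → h ≤ t + s → 2 ^ (n ∸ s) ≤ 2 ^ t * 2 ^ (n ∸ h)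
2^[n∸s]≤2^t*2^[n∸h] n s t {h} h≤t+s = begin
  2 ^ (n ∸ s)         ≤⟨ ^-monoʳ-≤ 2 (m≤n+o⇒m∸n≤o n s n≤) ⟩
  2 ^ (t + (n ∸ h))   ≡⟨ ^-distribˡ-+-* 2 t (n ∸ h) ⟩
  2 ^ t * 2 ^ (n ∸ h) ∎
  where
  open ≤-Reasoning
  n≤ : n ≤ s + (t + (n ∸ h))
  n≤ = begin
    n                   ≤⟨ m≤n+m∸n n h ⟩
    h + (n ∸ h)         ≤⟨ +-monoˡ-≤ (n ∸ h) h≤t+s ⟩
    t + s + (n ∸ h)     ≡⟨ cong (_+ (n ∸ h)) (+-comm t s) ⟩
    s + t + (n ∸ h)     ≡⟨ +-assoc s t (n ∸ h) ⟩
    s + (t + (n ∸ h))   ∎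

-- The transpose permutation

-- Positions 0, …, n - 1 fill R rows of length k and then a partial row of length e; the value at
-- a position is its index when the same grid is read column by column instead.
module Transpose (k R e : ℕ) .{{_ : NonZero k}} (e≤k : e ≤ k) where

  n : ℕ
  n = R * k + e

  row col : ℕ → ℕ
  row p = p / k
  col p = p % k

  -- the first e columns have R + 1 entries, the others R
  vstart : ℕ → ℕ
  vstart j = j * R + j ⊓ e

  val : ℕ → ℕ
  val p = vstart (col p) + row p

  col<k : ∀ p → col p < k
  col<k p = m%n<n p k

  decompose : ∀ p → p ≡ col p + row p * k
  decompose p = m≡m%n+[m/n]*n p k

  row-col-injective : ∀ {p q} → row p ≡ row q → col p ≡ col q → p ≡ q
  row-col-injective {p} {q} rows cols = begin
    p                 ≡⟨ decompose p ⟩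
    col p + row p * k ≡⟨ cong₂ (λ c r → c + r * k) cols rows ⟩
    col q + row q * k ≡⟨ decompose q ⟨
    q                 ∎
    where open ≡-Reasoning

  row-col-of : ∀ {c} i → c < k → row (c + i * k) ≡ i × col (c + i * k) ≡ c
  row-col-of {c} i c<k = row≡ , col≡
    where
    row≡ = begin
      (c + i * k) / k    ≡⟨ +-distrib-/-∣ʳ c (divides-refl i) ⟩
      c / k + i * k / k  ≡⟨ cong₂ _+_ (m<n⇒m/n≡0 c<k) (m*n/n≡m i k) ⟩
      i                  ∎
      where open ≡-Reasoning
    col≡ = trans ([m+kn]%n≡m%n c i k) (m<n⇒m%n≡m c<k)

  position-lex-mono : ∀ {p q} → (row p , col p) <ₗₑₓ (row q , col q) → p < q
  position-lex-mono {p} {q} (inj₁ row<) = begin-strict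
    p                 ≡⟨ decompose p ⟩
    col p + row p * k <⟨ +-monoˡ-< (row p * k) (col<k p) ⟩
    suc (row p) * k   ≤⟨ *-monoˡ-≤ k row< ⟩
    row q * k         ≤⟨ m≤n+m (row q * k) (col q) ⟩
    col q + row q * k ≡⟨ decompose q ⟨
    q                 ∎
    where open ≤-Reasoning
  position-lex-mono {p} {q} (inj₂ (rows , col<)) = begin-strict
    p                 ≡⟨ decompose p ⟩
    col p + row p * k <⟨ +-monoˡ-< (row p * k) col< ⟩
    col q + row p * k ≡⟨ cong (λ r → col q + r * k) rows ⟩
    col q + row q * k ≡⟨ decompose q ⟨
    q                 ∎
    where open ≤-Reasoning

  positions-sort : SortsLex (_< n) id row col
  positions-sort = sortsLex (λ _ _ → position-lex-mono) row-col-injective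

  last-row : ∀ {p} → p < n → row p < R ⊎ (row p ≡ R × col p < e)
  last-row {p} p<n with <-cmp (row p) R
  ... | tri< row<R _ _ = inj₁ row<R
  ... | tri≈ _ row≡R _ = inj₂ (row≡R , +-cancelʳ-< (R * k) (col p) e (begin-strict
    col p + R * k     ≡⟨ cong (λ r → col p + r * k) row≡R ⟨
    col p + row p * k ≡⟨ decompose p ⟨
    p                 <⟨ p<n ⟩
    R * k + e         ≡⟨ +-comm (R * k) e ⟩
    e + R * k         ∎))
    where open ≤-Reasoning
  ... | tri> _ _ R<row = contradiction p<n (≤⇒≯ (begin
    R * k + e         ≤⟨ +-monoʳ-≤ (R * k) e≤k ⟩
    R * k + k         ≡⟨ +-comm (R * k) k ⟩
    suc R * k         ≤⟨ *-monoˡ-≤ k R<row ⟩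
    row p * k         ≤⟨ m≤n+m (row p * k) (col p) ⟩
    col p + row p * k ≡⟨ decompose p ⟨
    p                 ∎))
    where open ≤-Reasoning

  row≤R : ∀ {p} → p < n → row p ≤ R
  row≤R p<n with last-row p<n
  ... | inj₁ row<R       = <⇒≤ row<R
  ... | inj₂ (row≡R , _) = ≤-reflexive row≡R

  row≡R⇒col<e : ∀ {p} → p < n → row p ≡ R → col p < e
  row≡R⇒col<e p<n row≡R with last-row p<n
  ... | inj₁ row<R       = contradiction row≡R (<⇒≢ row<R)
  ... | inj₂ (_ , col<e) = col<e

  vstart-step : ∀ j → vstart j + R ≤ vstart (suc j)
  vstart-step j = begin
    j * R + j ⊓ e + R ≡⟨ rearrange (j * R) (j ⊓ e) R ⟩
    R + j * R + j ⊓ e ≤⟨ +-monoʳ-≤ (R + j * R) (⊓-monoˡ-≤ e (n≤1+n j)) ⟩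
    vstart (suc j)    ∎
    where
    open ≤-Reasoning
    rearrange : ∀ a b c → a + b + c ≡ c + a + b
    rearrange = solve-∀

  vstart-step-< : ∀ {j} → j < e → vstart j + R < vstart (suc j)
  vstart-step-< {j} j<e = begin-strict
    j * R + j ⊓ e + R   ≡⟨ cong (λ m → j * R + m + R) (m≤n⇒m⊓n≡m (<⇒≤ j<e)) ⟩
    j * R + j + R       <⟨ n<1+n _ ⟩
    suc (j * R + j + R) ≡⟨ rearrange j R ⟩
    R + j * R + suc j   ≡⟨ cong (R + j * R +_) (m≤n⇒m⊓n≡m j<e) ⟨
    vstart (suc j)      ∎
    where
    open ≤-Reasoning
    rearrange : ∀ j R → suc (j * R + j + R) ≡ R + j * R + suc j
    rearrange = solve-∀

  vstart-mono : ∀ {i j} → i ≤ j → vstart i ≤ vstart j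
  vstart-mono i≤j = +-mono-≤ (*-monoˡ-≤ R i≤j) (⊓-monoˡ-≤ e i≤j)

  vstart≤n : ∀ {j} → j ≤ k → vstart j ≤ n
  vstart≤n {j} j≤k = subst (vstart j ≤_) (cong₂ _+_ (*-comm k R) (m≥n⇒m⊓n≡n e≤k)) (vstart-mono j≤k)

  val<vstart-next : ∀ {p} → p < n → val p < vstart (suc (col p))
  val<vstart-next {p} p<n with last-row p<n
  ... | inj₁ row<R = <-≤-trans (+-monoʳ-< (vstart (col p)) row<R) (vstart-step (col p))
  ... | inj₂ (row≡R , col<e) =
    subst (λ r → vstart (col p) + r < vstart (suc (col p))) (sym row≡R) (vstart-step-< col<e)

  value-lex-mono : ∀ {p q} → p < n → (col p , row p) <ₗₑₓ (col q , row q) → val p < val q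
  value-lex-mono {p} {q} p<n (inj₁ col<) =
    <-≤-trans (val<vstart-next p<n) (≤-trans (vstart-mono col<) (m≤m+n (vstart (col q)) (row q)))
  value-lex-mono {p} {q} _ (inj₂ (cols , row<)) =
    subst (λ c → vstart c + row p < val q) (sym cols) (+-monoʳ-< (vstart (col q)) row<)

  values-sort : SortsLex (_< n) val col row
  values-sort = sortsLex (λ p<n _ → value-lex-mono p<n) (cong₂ (λ c r → vstart c + r))

  val<n : ∀ {p} → p < n → val p < n
  val<n {p} p<n = <-≤-trans (val<vstart-next p<n) (vstart≤n (col<k p))

  val-injective : ∀ {p q} → p < n → q < n → val p ≡ val q → p ≡ q
  val-injective p<n q<n eq =
    let cols , rows = sortsLex-injective values-sort p<n q<n eq in row-col-injective rows cols

  transpose : Permutation′ n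
  transpose = proj₁ (permutationOf val val<n val-injective)

  transpose-val : ∀ i → toℕ (transpose ⟨$⟩ʳ i) ≡ val (toℕ i)
  transpose-val = proj₂ (permutationOf val val<n val-injective)

  in-row : ∀ {p} i {a b} → b ≤ k → T (interval (a + i * k) (b + i * k) p) →
           row p ≡ i × a ≤ col p × col p < b
  in-row {p} i {a} {b} b≤k p∈ =
    trans (cong row p≡c+ik) (proj₁ of-c) , subst (a ≤_) col≡ a≤c , subst (_< b) col≡ c<b
    where
    lo = proj₁ (interval-sound (a + i * k) (b + i * k) p∈)
    hi = proj₂ (interval-sound (a + i * k) (b + i * k) p∈)
    c = p ∸ i * k
    p≡c+ik : p ≡ c + i * k
    p≡c+ik = sym (m∸n+n≡m (≤-trans (m≤n+m (i * k) a) lo))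
    c<b : c < b
    c<b = +-cancelʳ-< (i * k) c b (subst (_< b + i * k) p≡c+ik hi)
    a≤c : a ≤ c
    a≤c = +-cancelʳ-≤ (i * k) a c (subst (a + i * k ≤_) p≡c+ik lo)
    of-c = row-col-of i (<-≤-trans c<b b≤k)
    col≡ : c ≡ col p
    col≡ = sym (trans (cong col p≡c+ik) (proj₂ of-c))

  in-column : ∀ {p} j {a b} → p < n → b ≤ R → T (interval (a + vstart j) (b + vstart j) (val p)) →
              col p ≡ j × a ≤ row p × row p < b
  in-column {p} j {a} {b} p<n b≤R p∈ = col≡j , a≤row , row<b
    where
    lo = proj₁ (interval-sound (a + vstart j) (b + vstart j) p∈)
    hi = proj₂ (interval-sound (a + vstart j) (b + vstart j) p∈)
    col≡j : col p ≡ j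
    col≡j with <-cmp (col p) j
    ... | tri≈ _ eq _ = eq
    ... | tri< col<j _ _ = contradiction (val<vstart-next p<n)
      (≤⇒≯ (≤-trans (vstart-mono col<j) (≤-trans (m≤n+m (vstart j) a) lo)))
    ... | tri> _ _ j<col = contradiction hi (≤⇒≯ (begin
      b + vstart j         ≤⟨ +-monoˡ-≤ (vstart j) b≤R ⟩
      R + vstart j         ≡⟨ +-comm R (vstart j) ⟩
      vstart j + R         ≤⟨ vstart-step j ⟩
      vstart (suc j)       ≤⟨ vstart-mono j<col ⟩
      vstart (col p)       ≤⟨ m≤m+n (vstart (col p)) (row p) ⟩
      val p                ∎))
      where open ≤-Reasoning
    val≡ : val p ≡ row p + vstart j
    val≡ = trans (cong (λ c → vstart c + row p) col≡j) (+-comm (vstart j) (row p))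
    a≤row = +-cancelʳ-≤ (vstart j) a (row p) (subst (a + vstart j ≤_) val≡ lo)
    row<b = +-cancelʳ-< (vstart j) (row p) b (subst (_< b + vstart j) val≡ hi)

  patternAt-transpose : ∀ X → patternAt transpose X ≡ patternOf (map val (positions X))
  patternAt-transpose X = cong patternOf (trans (select-cong X transpose-val) (select-map X toℕ val))

  module Events (c₀ r₀ : ℕ) (c₀≤k : c₀ ≤ k) (r₀≤R : r₀ ≤ R) .{{_ : NonZero R}} where

    rowHead rowTail colHead colTail : ℕ → ℕ → Bool
    rowHead i = interval (i * k) (c₀ + i * k)
    rowTail i = interval (c₀ + i * k) (k + i * k)
    colHead j = interval (vstart j) (r₀ + vstart j) ∘ val
    colTail j = interval (r₀ + vstart j) (R + vstart j) ∘ val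

    -- Row R is partial: when e ≤ c₀ all of it lies left of column c₀, so it needs no head event.
    needsHead : ℕ → Bool
    needsHead i = (i <ᵇ R) ∨ (c₀ <ᵇ e)

    headRows : List ℕ
    headRows = filterᵇ needsHead (applyUpTo suc R)

    rowTails rowHeads colTails colHeads events : List (ℕ → Bool)
    rowTails = map rowTail (upTo R)
    rowHeads = map rowHead headRows
    colTails = map colTail (upTo (k ∸ 1))
    colHeads = map colHead (applyUpTo suc (k ∸ 1))
    events   = rowTails ++ rowHeads ++ colTails ++ colHeads

    good : Vec Bool n → Bool
    good X = all (meets X) events

    rowTail∈ : ∀ {i} → i < R → rowTail i ∈ events
    rowTail∈ i<R = ∈-++⁺ˡ (∈-map⁺ rowTail (∈-upTo⁺ i<R))

    rowHead∈ : ∀ {i} → i < R → T (needsHead (suc i)) → rowHead (suc i) ∈ events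
    rowHead∈ i<R needed =
      ∈-++⁺ʳ rowTails (∈-++⁺ˡ (∈-map⁺ rowHead (∈-filter⁺ (T? ∘ needsHead) (∈-applyUpTo⁺ suc i<R) needed)))

    colTail∈ : ∀ {j} → suc j < k → colTail j ∈ events
    colTail∈ sj<k =
      ∈-++⁺ʳ rowTails (∈-++⁺ʳ rowHeads (∈-++⁺ˡ (∈-map⁺ colTail (∈-upTo⁺ (∸-monoˡ-< sj<k z<s)))))

    colHead∈ : ∀ {j} → suc j < k → colHead (suc j) ∈ events
    colHead∈ sj<k = ∈-++⁺ʳ rowTails (∈-++⁺ʳ rowHeads (∈-++⁺ʳ colTails
      (∈-map⁺ colHead (∈-applyUpTo⁺ suc (∸-monoˡ-< sj<k z<s)))))

    good⇒nonempty : ∀ {X} → T (good X) → T (nonemptyᵇ X)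
    good⇒nonempty {X} X-good
      with i , i∈X , _ ← meets-sound X _ (all-∈ (meets X) events X-good (rowTail∈ (>-nonZero⁻¹ R))) =
      member⇒nonempty X i i∈X
      where
      member⇒nonempty : ∀ {m} (X : Vec Bool m) i → T (lookup X i) → T (nonemptyᵇ X)
      member⇒nonempty (true ∷ X)  _           _   = tt
      member⇒nonempty (false ∷ X) (Fin.suc i) i∈X = member⇒nonempty X i i∈X

    module Listing (X : Vec Bool n) (X-good : T (good X)) {m} (m≡ : m ≡ length (positions X)) where

      point : Fin m → ℕ
      point a = nth (positions X) (toℕ a)

      point<n : ∀ a → point a < n
      point<n a with i , _ , eq ← select-sound X toℕ (subst (toℕ a <_) m≡ (Fin.toℕ<n a)) =
        subst (_< n) (sym eq) (Fin.toℕ<n i)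

      met : ∀ {E} → E ∈ events → ∃ λ a → T (E (point a))
      met {E} E∈ with i , i∈X , Ei ← meets-sound X E (all-∈ (meets X) events X-good E∈)
        with a , a< , eq ← select-complete X toℕ i∈X =
        fromℕ< a<m , subst (T ∘ E) (sym (trans (cong (nth (positions X)) (Fin.toℕ-fromℕ< a<m)) eq)) Ei
        where a<m = subst (a <_) (sym m≡) a<

      row-breaks : Breaks row col point
      row-breaks a {i} row≡ =
        d , d′ , proj₁ in-tail , proj₁ (proj₂ head) ,
        <-≤-trans (proj₂ (proj₂ head)) (proj₁ (proj₂ in-tail))
        where
        i<R : i < R
        i<R = subst (_≤ R) row≡ (row≤R (point<n a))
        d = proj₁ (met (rowTail∈ i<R))
        in-tail = in-row i ≤-refl (proj₂ (met (rowTail∈ i<R)))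
        from-event : T (needsHead (suc i)) → ∃ λ d′ → row (point d′) ≡ suc i × col (point d′) < c₀
        from-event needed with d′ , d′∈ ← met (rowHead∈ i<R needed)
                          with row≡ , _ , col< ← in-row (suc i) {0} c₀≤k d′∈ = d′ , row≡ , col<
        head : ∃ λ d′ → row (point d′) ≡ suc i × col (point d′) < c₀
        head with suc i <? R | c₀ <? e
        ... | yes si<R | _        = from-event (from T-∨ (inj₁ (<⇒<ᵇ si<R)))
        ... | no _     | yes c₀<e = from-event (from T-∨ (inj₂ (<⇒<ᵇ c₀<e)))
        ... | no si≮R  | no c₀≮e  =
          a , row≡ , <-≤-trans (row≡R⇒col<e (point<n a) (trans row≡ (≤-antisym i<R (≮⇒≥ si≮R))))
                               (≮⇒≥ c₀≮e)
        d′ = proj₁ head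

      col-breaks : Breaks col row point
      col-breaks a {j} col≡ =
        d , d′ , proj₁ in-tail , proj₁ in-head , <-≤-trans (proj₂ (proj₂ in-head)) (proj₁ (proj₂ in-tail))
        where
        sj<k : suc j < k
        sj<k = subst (_< k) col≡ (col<k (point a))
        d = proj₁ (met (colTail∈ sj<k))
        d′ = proj₁ (met (colHead∈ sj<k))
        in-tail = in-column j (point<n d) ≤-refl (proj₂ (met (colTail∈ sj<k)))
        in-head = in-column (suc j) {0} (point<n d′) r₀≤R (proj₂ (met (colHead∈ sj<k)))

    decode : ∀ {X Y} → T (good X) → T (good Y) → patternAt transpose X ≡ patternAt transpose Y → X ≡ Y
    decode {X} {Y} X-good Y-good same-pattern = positions-injective X Y len same-nth
      where
      xs = positions X
      ys = positions Y
      values≡ : patternOf (map val xs) ≡ patternOf (map val ys)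
      values≡ = trans (sym (patternAt-transpose X)) (trans same-pattern (patternAt-transpose Y))
      len : length xs ≡ length ys
      len = trans (sym (length-map val xs)) (trans (patternOf-length _ _ values≡) (length-map val ys))
      module LX = Listing X X-good refl
      module LY = Listing Y Y-good len
      <xs : ∀ (a : Fin (length xs)) → toℕ a < length xs
      <xs = Fin.toℕ<n
      <ys : ∀ (a : Fin (length xs)) → toℕ a < length ys
      <ys a = subst (toℕ a <_) len (Fin.toℕ<n a)
      same-positions : SameOrder id LX.point LY.point
      same-positions a b = ⇔.trans (increasing-⇔ xs (positions-increasing X) (<xs a) (<xs b))
                                   (⇔.sym (increasing-⇔ ys (positions-increasing Y) (<ys a) (<ys b)))
      same-values : SameOrder val LX.point LY.point
      same-values a b = mk⇔ (patternOf-map-< val xs ys values≡ (<xs a) (<xs b))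
                            (patternOf-map-< val ys xs (sym values≡) (<ys a) (<ys b))
      rows : ∀ a → row (LX.point a) ≡ row (LY.point a)
      rows = Decoding.major-determined positions-sort values-sort LX.point<n LY.point<n
                                       same-positions same-values LX.row-breaks LY.row-breaks
      cols : ∀ a → col (LX.point a) ≡ col (LY.point a)
      cols = Decoding.major-determined values-sort positions-sort LX.point<n LY.point<n
                                       same-values same-positions LX.col-breaks LY.col-breaks
      same-nth : ∀ {a} → a < length xs → nth xs a ≡ nth ys a
      same-nth a< = subst (λ b → nth xs b ≡ nth ys b) (Fin.toℕ-fromℕ< a<)
                          (row-col-injective (rows (fromℕ< a<)) (cols (fromℕ< a<)))

    #missing : (ℕ → Bool) → ℕ
    #missing E = 2 ^ (n ∸ card n E)

    deficit≤#missing : 2 ^ n ∸ numPatterns transpose ≤ sum (map #missing events)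
    deficit≤#missing = begin
      2 ^ n ∸ numPatterns transpose
        ≤⟨ deficit≤bad transpose good (λ {X} → good⇒nonempty {X}) (λ {X Y} → decode {X} {Y}) ⟩
      countᵇ (not ∘ good) (allSubsets n)
        ≤⟨ union-bound meets events (allSubsets n) ⟩
      sum (map (λ E → countᵇ (λ X → not (meets X E)) (allSubsets n)) events)
        ≡⟨ cong sum (map-cong (count-missing n) events) ⟩
      sum (map #missing events)
        ∎
      where open ≤-Reasoning

    row-fits : ∀ {i} → i < R → k + i * k ≤ n
    row-fits {i} i<R = begin
      suc i * k ≤⟨ *-monoˡ-≤ k i<R ⟩
      R * k     ≤⟨ m≤m+n (R * k) e ⟩
      n         ∎
      where open ≤-Reasoning

    #missing-interval : ∀ lo {hi} → hi ≤ n → #missing (interval lo hi) ≡ 2 ^ (n ∸ (hi ∸ lo))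
    #missing-interval lo {hi} hi≤n = cong (λ c → 2 ^ (n ∸ c)) (card-interval lo hi hi≤n)

    #missing-values : ∀ lo {hi} → hi ≤ n → #missing (interval lo hi ∘ val) ≡ 2 ^ (n ∸ (hi ∸ lo))
    #missing-values lo {hi} hi≤n =
      trans (cong (λ c → 2 ^ (n ∸ c)) (card-permute transpose {val} (interval lo hi) transpose-val))
            (#missing-interval lo hi≤n)

    #missing-rowTail : ∀ {i} → i ∈ upTo R → #missing (rowTail i) ≤ 2 ^ (n ∸ (k ∸ c₀))
    #missing-rowTail {i} i∈ = ≤-reflexive (trans (#missing-interval (c₀ + i * k) (row-fits (∈-upTo⁻ i∈)))
                                               (cong (λ c → 2 ^ (n ∸ c)) ([m+o]∸[n+o]≡m∸n k c₀ (i * k))))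

    #missing-rowHead : ∀ {i} → i ∈ headRows → #missing (rowHead i) ≤ 2 ^ (n ∸ c₀)
    #missing-rowHead {i} i∈ =
      ≤-reflexive (trans (#missing-interval (i * k) fits) (cong (λ c → 2 ^ (n ∸ c)) (m+n∸n≡m c₀ (i * k))))
      where
      fits : c₀ + i * k ≤ n
      fits with i∈R , needed ← ∈-filter⁻ (T? ∘ needsHead) {xs = applyUpTo suc R} i∈
        with to T-∨ needed
      ... | inj₁ i<R = ≤-trans (+-monoˡ-≤ (i * k) c₀≤k) (row-fits (<ᵇ⇒< i R i<R))
      ... | inj₂ c₀<e with _ , j<R , refl ← ∈-applyUpTo⁻ suc i∈R =
        ≤-trans (≤-reflexive (+-comm c₀ (i * k)))
                (+-mono-≤ (*-monoˡ-≤ k j<R) (<⇒≤ (<ᵇ⇒< c₀ e c₀<e)))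

    column-fits : ∀ {j} → j < k → R + vstart j ≤ n
    column-fits {j} j<k = ≤-trans (≤-reflexive (+-comm R (vstart j))) (≤-trans (vstart-step j) (vstart≤n j<k))

    #missing-colTail : ∀ {j} → j ∈ upTo (k ∸ 1) → #missing (colTail j) ≤ 2 ^ (n ∸ (R ∸ r₀))
    #missing-colTail {j} j∈ =
      ≤-reflexive (trans (#missing-values (r₀ + vstart j) (column-fits (<-trans (n<1+n j) (<∸1⇒suc< (∈-upTo⁻ j∈)))))
                         (cong (λ c → 2 ^ (n ∸ c)) ([m+o]∸[n+o]≡m∸n R r₀ (vstart j))))

    #missing-colHead : ∀ {j} → j ∈ applyUpTo suc (k ∸ 1) → #missing (colHead j) ≤ 2 ^ (n ∸ r₀)
    #missing-colHead j∈ with j , j<k∸1 , refl ← ∈-applyUpTo⁻ suc j∈ =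
      ≤-reflexive (trans (#missing-values (vstart (suc j))
                           (≤-trans (+-monoˡ-≤ (vstart (suc j)) r₀≤R) (column-fits (<∸1⇒suc< j<k∸1))))
                         (cong (λ c → 2 ^ (n ∸ c)) (m+n∸n≡m r₀ (vstart (suc j)))))

    #missing-sum≤ : sum (map #missing events) ≤
                    R * (2 ^ (n ∸ (k ∸ c₀)) + 2 ^ (n ∸ c₀)) + (k ∸ 1) * (2 ^ (n ∸ (R ∸ r₀)) + 2 ^ (n ∸ r₀))
    #missing-sum≤ = begin
      total events
        ≡⟨ split ⟩
      total rowTails + (total rowHeads + (total colTails + total colHeads))
        ≤⟨ +-mono-≤ rowTails≤ (+-mono-≤ rowHeads≤ (+-mono-≤ colTails≤ colHeads≤)) ⟩
      R * wA + (R * wB + ((k ∸ 1) * wC + (k ∸ 1) * wD))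
        ≡⟨ regroup R (k ∸ 1) wA wB wC wD ⟩
      R * (wA + wB) + (k ∸ 1) * (wC + wD)
        ∎
      where
      open ≤-Reasoning
      total : List (ℕ → Bool) → ℕ
      total Es = sum (map #missing Es)
      wA = 2 ^ (n ∸ (k ∸ c₀))
      wB = 2 ^ (n ∸ c₀)
      wC = 2 ^ (n ∸ (R ∸ r₀))
      wD = 2 ^ (n ∸ r₀)
      split : total events ≡ total rowTails + (total rowHeads + (total colTails + total colHeads))
      split = trans (sum-map-++ #missing rowTails _) (cong (total rowTails +_)
                (trans (sum-map-++ #missing rowHeads _) (cong (total rowHeads +_) (sum-map-++ #missing colTails colHeads))))
      rowTails≤ : total rowTails ≤ R * wA
      rowTails≤ = subst (λ l → total rowTails ≤ l * wA) (length-upTo R)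
                        (sum-map-map-≤ #missing rowTail (upTo R) #missing-rowTail)
      rowHeads≤ : total rowHeads ≤ R * wB
      rowHeads≤ = ≤-trans (sum-map-map-≤ #missing rowHead headRows #missing-rowHead)
                          (*-monoˡ-≤ wB (≤-trans (length-filter (T? ∘ needsHead) (applyUpTo suc R))
                                                 (≤-reflexive (length-applyUpTo suc R))))
      colTails≤ : total colTails ≤ (k ∸ 1) * wC
      colTails≤ = subst (λ l → total colTails ≤ l * wC) (length-upTo (k ∸ 1))
                        (sum-map-map-≤ #missing colTail (upTo (k ∸ 1)) #missing-colTail)
      colHeads≤ : total colHeads ≤ (k ∸ 1) * wD
      colHeads≤ = subst (λ l → total colHeads ≤ l * wD) (length-applyUpTo suc (k ∸ 1))
                        (sum-map-map-≤ #missing colHead (applyUpTo suc (k ∸ 1)) #missing-colHead)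
      regroup : ∀ R K a b c d → R * a + (R * b + (K * c + K * d)) ≡ R * (a + b) + K * (c + d)
      regroup = solve-∀

    -- With W = 2 ^ (n ∸ h), an event of size s is missed by 2 ^ (n ∸ s) ≤ 2 ^ t * W subsets when h ≤ t + s.
    deficit-scaled : ∀ {h tA tB tC tD} → h ≤ n →
                     h ≤ tA + (k ∸ c₀) → h ≤ tB + c₀ → h ≤ tC + (R ∸ r₀) → h ≤ tD + r₀ →
                     (2 ^ n ∸ numPatterns transpose) * 2 ^ h ≤
                     (R * (2 ^ tA + 2 ^ tB) + (k ∸ 1) * (2 ^ tC + 2 ^ tD)) * 2 ^ n
    deficit-scaled {h} {tA} {tB} {tC} {tD} h≤n hA hB hC hD = begin
      (2 ^ n ∸ numPatterns transpose) * 2 ^ h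
        ≤⟨ *-monoˡ-≤ (2 ^ h) (≤-trans deficit≤#missing (≤-trans #missing-sum≤ scaled-terms)) ⟩
      (R * (2 ^ tA * W + 2 ^ tB * W) + K * (2 ^ tC * W + 2 ^ tD * W)) * 2 ^ h
        ≡⟨ factor R K (2 ^ tA) (2 ^ tB) (2 ^ tC) (2 ^ tD) W (2 ^ h) ⟩
      M * (W * 2 ^ h) ≡⟨ cong (M *_) W*2^h≡2^n ⟩
      M * 2 ^ n       ∎
      where
      open ≤-Reasoning
      K = k ∸ 1
      W = 2 ^ (n ∸ h)
      M = R * (2 ^ tA + 2 ^ tB) + K * (2 ^ tC + 2 ^ tD)
      W*2^h≡2^n : W * 2 ^ h ≡ 2 ^ n
      W*2^h≡2^n = trans (sym (^-distribˡ-+-* 2 (n ∸ h) h)) (cong (2 ^_) (m∸n+n≡m h≤n))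
      scale : ∀ s t → h ≤ t + s → 2 ^ (n ∸ s) ≤ 2 ^ t * W
      scale s t = 2^[n∸s]≤2^t*2^[n∸h] n s t
      scaled-terms : R * (2 ^ (n ∸ (k ∸ c₀)) + 2 ^ (n ∸ c₀)) + K * (2 ^ (n ∸ (R ∸ r₀)) + 2 ^ (n ∸ r₀)) ≤
                       R * (2 ^ tA * W + 2 ^ tB * W) + K * (2 ^ tC * W + 2 ^ tD * W)
      scaled-terms = +-mono-≤ (*-monoʳ-≤ R (+-mono-≤ (scale (k ∸ c₀) tA hA) (scale c₀ tB hB)))
                                (*-monoʳ-≤ K (+-mono-≤ (scale (R ∸ r₀) tC hC) (scale r₀ tD hD)))
      factor : ∀ R K a b c d W P →
               (R * (a * W + b * W) + K * (c * W + d * W)) * P ≡ (R * (a + b) + K * (c + d)) * (W * P)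
      factor = solve-∀

-- Choice of the parameters

square-bound-odd : ∀ D M k h N → D * 2 ^ h ≤ M * N → M < 6 * k → 1 ≤ N →
                   D ^ 2 * 2 ^ (h + h) < (6 * k * N) ^ 2
square-bound-odd D M k h N scaled M<6k 1≤N = begin-strict
  D ^ 2 * 2 ^ (h + h)     ≡⟨ cong (D ^ 2 *_) (^-distribˡ-+-* 2 h h) ⟩
  D ^ 2 * (2 ^ h * 2 ^ h) ≡⟨ square-* D (2 ^ h) ⟩
  (D * 2 ^ h) ^ 2         ≤⟨ ^-monoˡ-≤ 2 scaled ⟩
  (M * N) ^ 2             <⟨ ^-monoˡ-< 2 (*-monoˡ-< N {{>-nonZero 1≤N}} M<6k) ⟩
  (6 * k * N) ^ 2         ∎
  where
  open ≤-Reasoning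
  square-* : ∀ D P → D * (D * 1) * (P * P) ≡ D * P * (D * P * 1)
  square-* = solve-∀

-- Here the exponent k + 1 = 2h + 1 is odd; the lost factor √2 is paid for by M ≤ 4k, as 4√2 < 6.
square-bound-even : ∀ D M k h N → D * 2 ^ h ≤ M * N → M ≤ 4 * k → 1 ≤ k → 1 ≤ N →
                    D ^ 2 * 2 ^ suc (h + h) < (6 * k * N) ^ 2
square-bound-even D M k h N scaled M≤4k 1≤k 1≤N = begin-strict
  D ^ 2 * 2 ^ suc (h + h)       ≡⟨ cong (λ P → D ^ 2 * (2 * P)) (^-distribˡ-+-* 2 h h) ⟩
  D ^ 2 * (2 * (2 ^ h * 2 ^ h)) ≡⟨ square-* D (2 ^ h) ⟩
  2 * (D * 2 ^ h) ^ 2           ≤⟨ *-monoʳ-≤ 2 (^-monoˡ-≤ 2 (≤-trans scaled (*-monoˡ-≤ N M≤4k))) ⟩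
  2 * (4 * k * N) ^ 2           ≡⟨ thirty-two k N ⟩
  32 * (k * N) ^ 2              <⟨ *-monoˡ-< ((k * N) ^ 2) {{kN≢0}} (m<m+n 32 {4} z<s) ⟩
  36 * (k * N) ^ 2              ≡⟨ thirty-six k N ⟩
  (6 * k * N) ^ 2               ∎
  where
  open ≤-Reasoning
  kN≢0 = >-nonZero (*-mono-≤ (*-mono-≤ 1≤k 1≤N) (*-mono-≤ (*-mono-≤ 1≤k 1≤N) (s≤s z≤n)))
  square-* : ∀ D P → D * (D * 1) * (2 * (P * P)) ≡ 2 * (D * P * (D * P * 1))
  square-* = solve-∀
  thirty-two : ∀ k N → 2 * (4 * k * N * (4 * k * N * 1)) ≡ 32 * (k * N * (k * N * 1))
  thirty-two = solve-∀
  thirty-six : ∀ k N → 36 * (k * N * (k * N * 1)) ≡ 6 * k * N * (6 * k * N * 1)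
  thirty-six = solve-∀

-- 2 ^ n ∸ |P(σ)| < 6k · 2 ^ (n - (k + 1) / 2), squared to clear the half-integer exponent
DeficitBound : ℕ → ℕ → Set
DeficitBound n k = ∃[ σ ] (2 ^ n ∸ numPatterns {n} σ) ^ 2 * 2 ^ suc k < (6 * k * 2 ^ n) ^ 2

deficitBound-trivial : ∀ n → DeficitBound n 1
deficitBound-trivial n =
  Permutation.id , square-bound-odd D 2 1 1 (2 ^ n) D*2≤2*2^n (s≤s (s≤s (s≤s z≤n))) (m^n>0 2 n)
  where
  D = 2 ^ n ∸ numPatterns {n} Permutation.id
  D*2≤2*2^n : D * 2 ≤ 2 * 2 ^ n
  D*2≤2*2^n = ≤-trans (*-monoˡ-≤ 2 (m∸n≤m (2 ^ n) (numPatterns {n} Permutation.id)))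
                      (≤-reflexive (*-comm (2 ^ n) 2))

-- c₀ = r₀ = h: every event has at least h elements.
deficitBound-even : ∀ {h R e} → 1 ≤ h → e ≤ h + h → h + h ≤ R → R ≤ suc (h + h) →
                    DeficitBound (R * (h + h) + e) (h + h)
deficitBound-even {suc g} {R} {e} _ e≤k k≤R R≤1+k =
  transpose , square-bound-even D M k h (2 ^ n) scaled M≤4k z<s (m^n>0 2 n)
  where
  h = suc g
  k = h + h
  R≢0 = >-nonZero (≤-trans z<s k≤R)
  open Transpose k R e e≤k
  open Events h h (m≤n+m h h) (≤-trans (m≤n+m h h) k≤R) {{R≢0}}
  h≤n : h ≤ n
  h≤n = ≤-trans (m≤m+n h h) (≤-trans k≤R (≤-trans (m≤m*n R k) (m≤m+n (R * k) e)))
  D = 2 ^ n ∸ numPatterns transpose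
  M = R * (1 + 1) + (k ∸ 1) * (1 + 1)
  scaled : D * 2 ^ h ≤ M * 2 ^ n
  scaled = deficit-scaled {h} {0} {0} {0} {0} h≤n (≤-reflexive (sym (m+n∸n≡m h h))) ≤-refl
                          (m+n≤o⇒m≤o∸n h k≤R) ≤-refl
  M≤4k : M ≤ 4 * k
  M≤4k = ≤-trans (+-monoˡ-≤ _ (*-monoˡ-≤ (1 + 1) R≤1+k)) (≤-reflexive (four g))
    where
    four : ∀ g → suc (suc g + suc g) * (1 + 1) + (g + suc g) * (1 + 1) ≡ 4 * (suc g + suc g)
    four = solve-∀

-- c₀ = r₀ = h: the head events have h elements, one less than h + 1, whence the factors 2 ^ 1.
deficitBound-odd-square : ∀ {h e} → e ≤ suc (h + h) →
                          DeficitBound (suc (h + h) * suc (h + h) + e) (suc (h + h))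
deficitBound-odd-square {h} {e} e≤k =
  transpose , subst (λ x → D ^ 2 * 2 ^ x < (6 * k * 2 ^ n) ^ 2) (cong suc (+-suc h h))
                    (square-bound-odd D M k (suc h) (2 ^ n) scaled M<6k (m^n>0 2 n))
  where
  k = suc (h + h)
  open Transpose k k e e≤k
  open Events h h (m≤n+m h (suc h)) (m≤n+m h (suc h))
  H≤k∸h : suc h ≤ k ∸ h
  H≤k∸h = ≤-reflexive (sym (m+n∸n≡m (suc h) h))
  H≤n : suc h ≤ n
  H≤n = ≤-trans (m≤m+n (suc h) h) (≤-trans (m≤m*n k k) (m≤m+n (k * k) e))
  D = 2 ^ n ∸ numPatterns transpose
  M = k * (1 + 2) + (k ∸ 1) * (1 + 2)
  scaled : D * 2 ^ suc h ≤ M * 2 ^ n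
  scaled = deficit-scaled {suc h} {0} {1} {0} {1} H≤n H≤k∸h ≤-refl H≤k∸h ≤-refl
  M<6k : M < 6 * k
  M<6k = subst (M <_) (six h) (m<m+n M {3} z<s)
    where
    six : ∀ h → suc (h + h) * (1 + 2) + (h + h) * (1 + 2) + 3 ≡ 6 * suc (h + h)
    six = solve-∀

-- c₀ = h, r₀ = h + 1: only the row heads are short; 3R + 2(k - 1) < 6k needs k > 1.
deficitBound-odd-oblong : ∀ {h e} → 1 ≤ h → e ≤ suc (h + h) →
                          DeficitBound (suc (suc (h + h)) * suc (h + h) + e) (suc (h + h))
deficitBound-odd-oblong {suc g} {e} _ e≤k =
  transpose , subst (λ x → D ^ 2 * 2 ^ x < (6 * k * 2 ^ n) ^ 2) (cong suc (+-suc h h))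
                    (square-bound-odd D M k (suc h) (2 ^ n) scaled M<6k (m^n>0 2 n))
  where
  h = suc g
  k = suc (h + h)
  open Transpose k (suc k) e e≤k
  open Events h (suc h) (m≤n+m h (suc h)) (s≤s (m≤n+m h (suc h)))
  H≤k∸h : suc h ≤ k ∸ h
  H≤k∸h = ≤-reflexive (sym (m+n∸n≡m (suc h) h))
  H≤n : suc h ≤ n
  H≤n = ≤-trans (m≤m+n (suc h) h) (≤-trans (n≤1+n k) (≤-trans (m≤m*n (suc k) k) (m≤m+n (suc k * k) e)))
  D = 2 ^ n ∸ numPatterns transpose
  M = suc k * (1 + 2) + (k ∸ 1) * (1 + 1)
  scaled : D * 2 ^ suc h ≤ M * 2 ^ n
  scaled = deficit-scaled {suc h} {0} {1} {0} {0} H≤n H≤k∸h ≤-refl H≤k∸h ≤-refl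
  M<6k : M < 6 * k
  M<6k = subst (M <_) (six g) (m<m+n M {2 * h} z<s)
    where
    six : ∀ g → suc (suc (suc g + suc g)) * (1 + 2) + (suc g + suc g) * (1 + 1) + 2 * suc g ≡
                6 * suc (suc g + suc g)
    six = solve-∀

half : ∀ k → ∃ λ h → k ≡ h + h ⊎ k ≡ suc (h + h)
half zero    = 0 , inj₁ refl
half (suc k) with half k
... | h , inj₁ refl = h , inj₂ refl
... | h , inj₂ refl = suc h , inj₁ (cong suc (sym (+-suc h h)))

deficitBound-grid : ∀ {k R e} → 2 ≤ k → e ≤ k → R ≡ k ⊎ R ≡ suc k → DeficitBound (R * k + e) k
deficitBound-grid {k} 2≤k e≤k R≡ with half k | R≡
... | zero  , inj₁ refl | _         = contradiction 2≤k λ ()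
... | zero  , inj₂ refl | _         = contradiction 2≤k λ { (s≤s ()) }
... | suc g , inj₁ refl | inj₁ refl = deficitBound-even z<s e≤k ≤-refl (n≤1+n _)
... | suc g , inj₁ refl | inj₂ refl = deficitBound-even z<s e≤k (n≤1+n _) ≤-refl
... | suc g , inj₂ refl | inj₁ refl = deficitBound-odd-square {suc g} e≤k
... | suc g , inj₂ refl | inj₂ refl = deficitBound-odd-oblong {suc g} z<s e≤k

floor-sqrt : ∀ n → ∃ λ k → k * k ≤ n × n < suc k * suc k
floor-sqrt zero    = 0 , z≤n , z<s
floor-sqrt (suc n) with k , lo , hi ← floor-sqrt n with suc k * suc k ≤? suc n
... | yes next≤ = suc k , next≤ , ≤-<-trans hi (*-mono-< (n<1+n (suc k)) (n<1+n (suc k)))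
... | no next≰  = k , m≤n⇒m≤1+n lo , ≰⇒> next≰

grid-shape : ∀ {n k} → k * k ≤ n → n < suc k * suc k →
             ∃₂ λ R e → e ≤ k × (R ≡ k ⊎ R ≡ suc k) × n ≡ R * k + e
grid-shape {n} {k} lo hi with n ∸ k * k ≤? k
... | yes e≤k = k , n ∸ k * k , e≤k , inj₁ refl , sym (m+[n∸m]≡n lo)
... | no e≰k  = suc k , e ∸ k , m≤n+o⇒m∸n≤o e k e≤k+k , inj₂ refl , n≡
  where
  e = n ∸ k * k
  e≤k+k : e ≤ k + k
  e≤k+k = m≤n+o⇒m∸n≤o n (k * k) (s≤s⁻¹ (subst (n <_) (expand k) hi))
    where
    expand : ∀ k → suc k * suc k ≡ suc (k * k + (k + k))
    expand = solve-∀
  n≡ : n ≡ suc k * k + (e ∸ k)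
  n≡ = begin
    n                   ≡⟨ m+[n∸m]≡n lo ⟨
    k * k + e           ≡⟨ cong (k * k +_) (m+[n∸m]≡n (<⇒≤ (≰⇒> e≰k))) ⟨
    k * k + (k + (e ∸ k)) ≡⟨ regroup k (e ∸ k) ⟩
    suc k * k + (e ∸ k) ∎
    where
    open ≡-Reasoning
    regroup : ∀ k x → k * k + (k + x) ≡ suc k * k + x
    regroup = solve-∀

deficitBound : ∀ {n k} → 1 ≤ n → k * k ≤ n → n < suc k * suc k → DeficitBound n k
deficitBound {k = zero}          1≤n _  n<1 = contradiction n<1 (≤⇒≯ 1≤n)
deficitBound {n} {suc zero}      _   _  _   = deficitBound-trivial n
deficitBound {k = suc (suc k′)} _   lo hi
  with R , e , e≤k , R≡ , refl ← grid-shape {k = suc (suc k′)} lo hi =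
  deficitBound-grid (s≤s (s≤s z≤n)) e≤k R≡

mainTheorem1 : (n : ℕ) → 1 ≤ n →
    ∃[ σ ] ∃[ a ] ∃[ b ] ∃[ q ]
      (1 ≤ q × a * a ≤ n * (q * q) × n * (q * q) ≤ b * b ×
       ((2 ^ n ∸ numPatterns {n} σ) ^ (2 * q)) * 2 ^ b * q ^ (2 * q)
         < (6 * a * 2 ^ n) ^ (2 * q))
mainTheorem1 n 1≤n with k , lo , hi ← floor-sqrt n with σ , bound ← deficitBound {n} {k} 1≤n lo hi =
  σ , k , suc k , 1 , ≤-refl ,
  subst (k * k ≤_) (sym (*-identityʳ n)) lo ,
  subst (_≤ suc k * suc k) (sym (*-identityʳ n)) (<⇒≤ hi) ,
  subst (_< (6 * k * 2 ^ n) ^ 2) (sym (*-identityʳ _)) bound
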